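{- Let $G$ be a Hamiltonian bipartite graph with bipartition $(X,Y)$, $n$ vertices and $|X|=|Y|$. Then $\mathrm{cap}^\times_2(G)=\mathrm{cap}^\boxtimes_2(G)=|X|=\frac{n}{2}$.
   Context: $d_G$ denotes shortest-path distance. For an integer $\ell\ge 0$, a walk (resp. weak walk) of length $\ell$ on $G$ is a function $f:\{0,\dots,\ell\}\to V(G)$ with $f(i)f(i+1)\in E(G)$ (resp. $f(i)=f(i+1)$ or $f(i)f(i+1)\in E(G)$) for all $0\le i<\ell$; an $\ell$-track (resp. weak $\ell$-track) is a surjective one. For $f,g:\{0,\dots,\ell\}\to V(G)$, $m_G(f,g)=\min_i d_G(f(i),g(i))$; for a family $F=\{f_1,\dots,f_p\}$ with $p\ge2$, $m_G(F)=\min_{i\ne j}m_G(f_i,f_j)$. An $\ell$-tour (resp. weak $\ell$-tour) is a family of $\ell$-tracks (resp. weak $\ell$-tracks). $\mathrm{cap}^\times_d(G)$ is the maximum $c$ such that there is an $\ell$-tour $F=\{f_1,\dots,f_c\}$ (some $\ell$) with $m_G(F)=d$; $\mathrm{cap}^\boxtimes_d(G)$ is the maximum $c$ such that there is a weak $\ell$-tour $F=\{f_1,\dots,f_c\}$ with $m_G(F)=d$. (These are defined for natural $d$ not exceeding the direct, resp. strong, vertex span, which is the maximum of $m_G(f,g)$ over pairs of $\ell$-tracks, resp. weak $\ell$-tracks.) -}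

module Defs where

open import Data.Nat using (ℕ; zero; suc; _≤_)
open import Data.Fin using (Fin; zero; suc; inject₁; fromℕ)
open import Data.Fin.Subset using (Subset; _∈_; _∉_)
open import Data.Product using (Σ; ∃; _×_; _,_)
open import Data.Sum using (_⊎_)
open import Relation.Binary.PropositionalEquality using (_≡_; _≢_)
open import Relation.Nullary using (¬_)
open import Function.Definitions using (Injective; Surjective)

record Graph (n : ℕ) : Set₁ where
  field
    E     : Fin n → Fin n → Set
    sym   : ∀ {u v} → E u v → E v u
    irrefl : ∀ {u} → ¬ E u u
open Graph public

IsWalk : ∀ {n} → Graph n → (ℓ : ℕ) → (Fin (suc ℓ) → Fin n) → Set
IsWalk G ℓ f = ∀ (i : Fin ℓ) → E G (f (inject₁ i)) (f (suc i))

IsWeakWalk : ∀ {n} → Graph n → (ℓ : ℕ) → (Fin (suc ℓ) → Fin n) → Set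
IsWeakWalk G ℓ f = ∀ (i : Fin ℓ) → f (inject₁ i) ≡ f (suc i) ⊎ E G (f (inject₁ i)) (f (suc i))

IsTrack : ∀ {n} → Graph n → (ℓ : ℕ) → (Fin (suc ℓ) → Fin n) → Set
IsTrack G ℓ f = IsWalk G ℓ f × Surjective _≡_ _≡_ f

IsWeakTrack : ∀ {n} → Graph n → (ℓ : ℕ) → (Fin (suc ℓ) → Fin n) → Set
IsWeakTrack G ℓ f = IsWeakWalk G ℓ f × Surjective _≡_ _≡_ f

WalkBetween : ∀ {n} → Graph n → Fin n → Fin n → ℕ → Set
WalkBetween {n} G u v k =
  Σ (Fin (suc k) → Fin n) λ w → IsWalk G k w × w zero ≡ u × w (fromℕ k) ≡ v

DistGe : ∀ {n} → Graph n → Fin n → Fin n → ℕ → Set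
DistGe G u v d = ∀ k → WalkBetween G u v k → d ≤ k

Dist : ∀ {n} → Graph n → Fin n → Fin n → ℕ → Set
Dist G u v d = WalkBetween G u v d × DistGe G u v d

-- m_G(F) = d for a family F = {f_1,…,f_c} of maps {0..ℓ} → V:
-- the minimum over i ≠ j and times t of d_G(f_i(t), f_j(t)) equals d.
MinDistFamily : ∀ {n} → Graph n → (c ℓ : ℕ) → (Fin c → Fin (suc ℓ) → Fin n) → ℕ → Set
MinDistFamily G c ℓ F d =
  (∀ i j → i ≢ j → ∀ t → DistGe G (F i t) (F j t) d)
  × (Σ (Fin c) λ i → Σ (Fin c) λ j → i ≢ j × Σ (Fin (suc ℓ)) λ t → Dist G (F i t) (F j t) d)

HasTour : ∀ {n} → Graph n → (d c : ℕ) → Set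
HasTour {n} G d c = Σ ℕ λ ℓ → Σ (Fin c → Fin (suc ℓ) → Fin n) λ F →
  (∀ i → IsTrack G ℓ (F i)) × MinDistFamily G c ℓ F d

HasWeakTour : ∀ {n} → Graph n → (d c : ℕ) → Set
HasWeakTour {n} G d c = Σ ℕ λ ℓ → Σ (Fin c → Fin (suc ℓ) → Fin n) λ F →
  (∀ i → IsWeakTrack G ℓ (F i)) × MinDistFamily G c ℓ F d

IsMaximum : (ℕ → Set) → ℕ → Set
IsMaximum P c = P c × (∀ c' → P c' → c' ≤ c)

DirectCap : ∀ {n} → Graph n → ℕ → ℕ → Set
DirectCap G d c = IsMaximum (HasTour G d) c

StrongCap : ∀ {n} → Graph n → ℕ → ℕ → Set
StrongCap G d c = IsMaximum (HasWeakTour G d) c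

IsBipartition : ∀ {n} → Graph n → Subset n → Set
IsBipartition G X = ∀ {u v} → E G u v → (u ∈ X × v ∉ X) ⊎ (u ∉ X × v ∈ X)

Hamiltonian : ∀ {n} → Graph n → Set
Hamiltonian {n} G = 3 ≤ n × Σ (Fin (suc n) → Fin n) λ h →
  IsWalk G n h × h zero ≡ h (fromℕ n) × Injective _≡_ _≡_ (λ i → h (inject₁ i))

-- Unroll the Hamiltonian cycle into an n-periodic map ℕ → V and start track i at cycle
-- position 2i, all tracks then running along the cycle. Two of these |X| tracks are
-- always an even number of steps apart, strictly between 0 and n, so they sit at distinct
-- vertices on the same side of the bipartition, i.e. at distance ≥ 2; consecutive tracks
-- are at distance exactly 2. Conversely, vertices pairwise at distance ≥ 2 occupy cycle
-- positions p whose halves ⌊p/2⌋ are pairwise distinct, so no more than n/2 tracks, weak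
-- or not, can even start.
module Submission where

open import Defs renaming (sym to E-sym)
open import Data.Bool.Properties using (¬-not)
open import Data.Nat
  using (ℕ; zero; suc; _+_; _*_; _∸_; _≤_; _<_; z≤n; s≤s; z<s; s≤s⁻¹; NonZero; >-nonZero; ⌊_/2⌋; pred)
open import Data.Nat.Properties
  using (+-comm; +-suc; +-identityʳ; *-suc; *-identityʳ; +-cancelʳ-≡; 1+n≢n; <⇒≢; <⇒≱; <⇒≤
        ; ≤-trans; ≤-<-trans; <-irrefl; <-cmp; m≤m+n; m≤n+m; m∸n≤m; m+[n∸m]≡n
        ; +-mono-<; +-monoˡ-≤; *-monoʳ-≤; m≤n⇒m<n∨m≡n; m≤n⇒∃[o]m+o≡n)
open import Data.Nat.DivMod
  using (_/_; _%_; _mod_; %-distribˡ-+; m%n%n≡m%n; m≡m%n+[m/n]*n; m<n⇒m%n≡m; n%n≡0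
        ; [m+n]%n≡m%n; m*n/n≡m)
open import Data.Nat.Tactic.RingSolver using (solve-∀)
open import Data.Fin using (Fin; zero; suc; toℕ; fromℕ<; fromℕ; inject₁; punchOut)
open import Data.Fin.Properties
  using (toℕ-injective; toℕ-fromℕ<; toℕ-inject₁; toℕ-fromℕ; toℕ<n; fromℕ<-cong
        ; fromℕ<-injective; any?; punchOut-injective; injective⇒≤; _≟_)
open import Data.Fin.Subset using (Subset; ∁; ∣_∣)
open import Data.Fin.Subset.Properties using (∣∁p∣≡n∸∣p∣; ∣p∣≤n)
open import Data.Vec using (lookup)
open import Data.Vec.Properties using ([]=⇒lookup; lookup⇒[]=)
open import Data.Product using (_×_; _,_; proj₁; proj₂; ∃; map₁)
open import Data.Sum using (_⊎_; inj₁; inj₂)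
import Data.Sum as Sum
open import Data.Empty using (⊥-elim)
open import Relation.Nullary using (¬_; yes; no; contradiction)
open import Relation.Binary using (tri<; tri≈; tri>)
open import Relation.Binary.PropositionalEquality
  using (_≡_; _≢_; refl; sym; trans; cong; subst; subst₂; ≢-sym; module ≡-Reasoning)
open import Function using (_∘_)
open import Function.Definitions using (Injective; Surjective)

open ≡-Reasoning

injective⇒surjective : ∀ {k} {f : Fin k → Fin k} → Injective _≡_ _≡_ f → Surjective _≡_ _≡_ f
injective⇒surjective {suc k} {f} f-injective y with any? (λ x → f x ≟ y)
... | yes (x , fx≡y) = x , λ { refl → fx≡y }
... | no y∉image = ⊥-elim (<-irrefl refl (injective⇒≤ g-injective))
  where
  g : Fin (suc k) → Fin k
  g x = punchOut {i = y} {j = f x} (λ y≡fx → y∉image (x , sym y≡fx))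
  g-injective : Injective _≡_ _≡_ g
  g-injective {a} {b} ga≡gb = f-injective
    (punchOut-injective (λ e → y∉image (a , sym e)) (λ e → y∉image (b , sym e)) ga≡gb)

[o+m%n]%n≡[o+m]%n : ∀ o m n .{{_ : NonZero n}} → (o + m % n) % n ≡ (o + m) % n
[o+m%n]%n≡[o+m]%n o m n = begin
  (o + m % n) % n            ≡⟨ %-distribˡ-+ o (m % n) n ⟩
  (o % n + m % n % n) % n    ≡⟨ cong (λ x → (o % n + x) % n) (m%n%n≡m%n m n) ⟩
  (o % n + m % n) % n        ≡⟨ %-distribˡ-+ o m n ⟨
  (o + m) % n                ∎

-- From (d + r) % n ≡ r, d is a multiple of n.
[d+r]%n≢r : ∀ {d n} r .{{_ : NonZero n}} → 0 < d → d < n → (d + r) % n ≢ r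
[d+r]%n≢r {d} {n} r 0<d d<n [d+r]%n≡r = not-multiple ((d + r) / n) d≡[d+r]/n*n
  where
  d≡[d+r]/n*n : d ≡ (d + r) / n * n
  d≡[d+r]/n*n = +-cancelʳ-≡ r d _ (begin
    d + r                          ≡⟨ m≡m%n+[m/n]*n (d + r) n ⟩
    (d + r) % n + (d + r) / n * n  ≡⟨ cong (_+ (d + r) / n * n) [d+r]%n≡r ⟩
    r + (d + r) / n * n            ≡⟨ +-comm r _ ⟩
    (d + r) / n * n + r            ∎)
  not-multiple : ∀ q → d ≢ q * n
  not-multiple zero    d≡0     = <⇒≢ 0<d (sym d≡0)
  not-multiple (suc q) d≡n+q*n = <⇒≱ d<n (subst (n ≤_) (sym d≡n+q*n) (m≤m+n n (q * n)))

⌊n/2⌋<m : ∀ a {m} → a < m + m → ⌊ a /2⌋ < m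
⌊n/2⌋<m a             {zero}  ()
⌊n/2⌋<m zero          {suc m} _ = z<s
⌊n/2⌋<m (suc zero)    {suc m} _ = z<s
⌊n/2⌋<m (suc (suc a)) {suc m} a+2<m+m =
  s≤s (⌊n/2⌋<m a (s≤s⁻¹ (subst (suc (suc a) ≤_) (+-suc m m) (s≤s⁻¹ a+2<m+m))))

⌊m/2⌋≡⌊n/2⌋⇒m≡n⊎1+m≡n⊎m≡1+n : ∀ a b → ⌊ a /2⌋ ≡ ⌊ b /2⌋ → a ≡ b ⊎ suc a ≡ b ⊎ a ≡ suc b
⌊m/2⌋≡⌊n/2⌋⇒m≡n⊎1+m≡n⊎m≡1+n zero          zero          _ = inj₁ refl
⌊m/2⌋≡⌊n/2⌋⇒m≡n⊎1+m≡n⊎m≡1+n zero          (suc zero)    _ = inj₂ (inj₁ refl)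
⌊m/2⌋≡⌊n/2⌋⇒m≡n⊎1+m≡n⊎m≡1+n (suc zero)    zero          _ = inj₂ (inj₂ refl)
⌊m/2⌋≡⌊n/2⌋⇒m≡n⊎1+m≡n⊎m≡1+n (suc zero)    (suc zero)    _ = inj₁ refl
⌊m/2⌋≡⌊n/2⌋⇒m≡n⊎1+m≡n⊎m≡1+n zero          (suc (suc b)) ()
⌊m/2⌋≡⌊n/2⌋⇒m≡n⊎1+m≡n⊎m≡1+n (suc zero)    (suc (suc b)) ()
⌊m/2⌋≡⌊n/2⌋⇒m≡n⊎1+m≡n⊎m≡1+n (suc (suc a)) zero          ()
⌊m/2⌋≡⌊n/2⌋⇒m≡n⊎1+m≡n⊎m≡1+n (suc (suc a)) (suc zero)    ()
⌊m/2⌋≡⌊n/2⌋⇒m≡n⊎1+m≡n⊎m≡1+n (suc (suc a)) (suc (suc b)) eq =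
  Sum.map (cong (2 +_)) (Sum.map (cong (2 +_)) (cong (2 +_)))
    (⌊m/2⌋≡⌊n/2⌋⇒m≡n⊎1+m≡n⊎m≡1+n a b (cong pred eq))

3≤m+m⇒2≤m : ∀ m → 3 ≤ m + m → 2 ≤ m
3≤m+m⇒2≤m (suc zero)    (s≤s (s≤s ()))
3≤m+m⇒2≤m (suc (suc m)) _ = s≤s (s≤s z≤n)

[m+m]/2≡m : ∀ m → (m + m) / 2 ≡ m
[m+m]/2≡m m = trans (cong (_/ 2) m+m≡m*2) (m*n/n≡m m 2)
  where
  m+m≡m*2 : m + m ≡ m * 2
  m+m≡m*2 = trans (cong (m +_) (sym (*-identityʳ m))) (sym (*-suc m 1))

∣p∣≡∣∁p∣⇒n≡∣p∣+∣p∣ : ∀ {n} (p : Subset n) → ∣ p ∣ ≡ ∣ ∁ p ∣ → n ≡ ∣ p ∣ + ∣ p ∣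
∣p∣≡∣∁p∣⇒n≡∣p∣+∣p∣ p ∣p∣≡∣∁p∣ =
  sym (trans (cong (∣ p ∣ +_) (trans ∣p∣≡∣∁p∣ (∣∁p∣≡n∸∣p∣ p))) (m+[n∸m]≡n (∣p∣≤n p)))

module _ {n} (G : Graph n) where

  edge⇒WalkBetween-1 : ∀ {u v} → E G u v → WalkBetween G u v 1
  edge⇒WalkBetween-1 {u} {v} e = (λ { zero → u ; (suc _) → v }) , (λ { zero → e }) , refl , refl

  path⇒WalkBetween-2 : ∀ {u v w} → E G u v → E G v w → WalkBetween G u w 2
  path⇒WalkBetween-2 {u} {v} {w} e₁ e₂ =
    (λ { zero → u ; (suc zero) → v ; (suc (suc _)) → w }) ,
    (λ { zero → e₁ ; (suc zero) → e₂ }) , refl , refl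

  ≡⊎E⇒¬DistGe-2 : ∀ {u v} → u ≡ v ⊎ E G u v → ¬ DistGe G u v 2
  ≡⊎E⇒¬DistGe-2 {u} (inj₁ refl) far = contradiction (far 0 ((λ _ → u) , (λ ()) , refl , refl)) λ ()
  ≡⊎E⇒¬DistGe-2     (inj₂ e)    far = contradiction (far 1 (edge⇒WalkBetween-1 e)) λ { (s≤s ()) }

  ≢∧¬E⇒DistGe-2 : ∀ {u v} → u ≢ v → ¬ E G u v → DistGe G u v 2
  ≢∧¬E⇒DistGe-2 u≢v ¬uv zero          (_ , _ , refl , refl)    = contradiction refl u≢v
  ≢∧¬E⇒DistGe-2 u≢v ¬uv (suc zero)    (_ , walk , refl , refl) = contradiction (walk zero) ¬uv
  ≢∧¬E⇒DistGe-2 u≢v ¬uv (suc (suc k)) _                        = s≤s (s≤s z≤n)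

  DistGe-2-sym : ∀ {u v} → DistGe G u v 2 → DistGe G v u 2
  DistGe-2-sym far = ≢∧¬E⇒DistGe-2
    (λ v≡u → ≡⊎E⇒¬DistGe-2 (inj₁ (sym v≡u)) far)
    (λ vu → ≡⊎E⇒¬DistGe-2 (inj₂ (E-sym G vu)) far)

  HasTour⇒HasWeakTour : ∀ {d c} → HasTour G d c → HasWeakTour G d c
  HasTour⇒HasWeakTour (ℓ , F , tracks , minDist) =
    ℓ , F , (λ i → map₁ (λ walk s → inj₂ (walk s)) (tracks i)) , minDist

module Bipartite {n} (G : Graph n) {X : Subset n} (bip : IsBipartition G X) where

  adjacent⇒sides-differ : ∀ {u v} → E G u v → lookup X u ≢ lookup X v
  adjacent⇒sides-differ {u} {v} e with bip e
  ... | inj₁ (u∈X , v∉X) = λ eq → v∉X (lookup⇒[]= v X (trans (sym eq) ([]=⇒lookup u∈X)))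
  ... | inj₂ (u∉X , v∈X) = λ eq → u∉X (lookup⇒[]= u X (trans eq ([]=⇒lookup v∈X)))

  same-side⇒¬adjacent : ∀ {u v} → lookup X u ≡ lookup X v → ¬ E G u v
  same-side⇒¬adjacent same e = adjacent⇒sides-differ e same

  walk-side-2-periodic : (f : ℕ → Fin n) → (∀ j → E G (f j) (f (suc j))) →
                         ∀ k a → lookup X (f (2 * k + a)) ≡ lookup X (f a)
  walk-side-2-periodic f step zero    a = refl
  walk-side-2-periodic f step (suc k) a = begin
    lookup X (f (2 * suc k + a))      ≡⟨ cong (λ x → lookup X (f (x + a))) (*-suc 2 k) ⟩
    lookup X (f (2 + (2 * k + a)))    ≡⟨ two-steps (2 * k + a) ⟩
    lookup X (f (2 * k + a))          ≡⟨ walk-side-2-periodic f step k a ⟩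
    lookup X (f a)                    ∎
    where
    two-steps : ∀ b → lookup X (f (2 + b)) ≡ lookup X (f b)
    two-steps b = trans (¬-not (≢-sym (adjacent⇒sides-differ (step (suc b)))))
                        (sym (¬-not (adjacent⇒sides-differ (step b))))

module HamiltonianCycle {n} (G : Graph n) (3≤n : 3 ≤ n)
  (h : Fin (suc n) → Fin n) (h-walk : IsWalk G n h) (h-closed : h zero ≡ h (fromℕ n))
  (h-injective : Injective _≡_ _≡_ (λ i → h (inject₁ i))) where

  private instance
    n-nonZero : NonZero n
    n-nonZero = >-nonZero (≤-trans z<s 3≤n)

  cycle : ℕ → Fin n
  cycle j = h (inject₁ (j mod n))

  cycle-cong-% : ∀ {a b} → a % n ≡ b % n → cycle a ≡ cycle b
  cycle-cong-% a%n≡b%n = cong (h ∘ inject₁) (fromℕ<-cong _ _ a%n≡b%n _ _)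

  toℕ-inject₁-mod : ∀ j → toℕ (inject₁ (j mod n)) ≡ j % n
  toℕ-inject₁-mod j = trans (toℕ-inject₁ _) (toℕ-fromℕ< _)

  h≡cycle∘toℕ : ∀ p → h p ≡ cycle (toℕ p)
  h≡cycle∘toℕ p with m≤n⇒m<n∨m≡n (s≤s⁻¹ (toℕ<n p))
  ... | inj₁ p<n = cong h (toℕ-injective (sym (trans (toℕ-inject₁-mod _) (m<n⇒m%n≡m p<n))))
  ... | inj₂ p≡n = begin
    h p               ≡⟨ cong h (toℕ-injective (trans p≡n (sym (toℕ-fromℕ n)))) ⟩
    h (fromℕ n)       ≡⟨ h-closed ⟨
    h zero            ≡⟨ cong h (toℕ-injective (sym (trans (toℕ-inject₁-mod _)
                           (trans (cong (_% n) p≡n) (n%n≡0 n))))) ⟩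
    cycle (toℕ p)     ∎

  cycle-step : ∀ j → E G (cycle j) (cycle (suc j))
  cycle-step j = subst (E G (cycle j)) h[1+pos]≡cycle[1+j] (h-walk (j mod n))
    where
    h[1+pos]≡cycle[1+j] : h (suc (j mod n)) ≡ cycle (suc j)
    h[1+pos]≡cycle[1+j] = trans (h≡cycle∘toℕ _) (cycle-cong-%
      (trans (cong (λ x → suc x % n) (toℕ-fromℕ< _)) ([o+m%n]%n≡[o+m]%n 1 j n)))

  cycle-+n : ∀ a → cycle (a + n) ≡ cycle a
  cycle-+n a = cycle-cong-% ([m+n]%n≡m%n a n)

  cycle-position : ∀ v → ∃ λ (p : Fin n) → cycle (toℕ p) ≡ v
  cycle-position v with injective⇒surjective h-injective v
  ... | p , hp≡v = p , (begin
    cycle (toℕ p)             ≡⟨ cong cycle (toℕ-inject₁ p) ⟨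
    cycle (toℕ (inject₁ p))   ≡⟨ h≡cycle∘toℕ (inject₁ p) ⟨
    h (inject₁ p)             ≡⟨ hp≡v refl ⟩
    v                         ∎)

  cycle-shift-≢ : ∀ {d} a → 0 < d → d < n → cycle a ≢ cycle (d + a)
  cycle-shift-≢ {d} a 0<d d<n cycle-a≡cycle-d+a = [d+r]%n≢r (a % n) 0<d d<n (begin
    (d + a % n) % n      ≡⟨ [o+m%n]%n≡[o+m]%n d a n ⟩
    (d + a) % n          ≡⟨ toℕ-fromℕ< _ ⟨
    toℕ ((d + a) mod n)  ≡⟨ cong toℕ (h-injective cycle-a≡cycle-d+a) ⟨
    toℕ (a mod n)        ≡⟨ toℕ-fromℕ< _ ⟩
    a % n                ∎)

  cycle-nearby : ∀ {a b} → a ≡ b ⊎ suc a ≡ b ⊎ a ≡ suc b → cycle a ≡ cycle b ⊎ E G (cycle a) (cycle b)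
  cycle-nearby {a}     (inj₁ refl)        = inj₁ refl
  cycle-nearby {a}     (inj₂ (inj₁ refl)) = inj₂ (cycle-step a)
  cycle-nearby {b = b} (inj₂ (inj₂ refl)) = inj₂ (E-sym G (cycle-step b))

  pairwise-DistGe-2⇒≤ : ∀ {m c} → n ≡ m + m → (S : Fin c → Fin n) →
                        (∀ i j → i ≢ j → DistGe G (S i) (S j) 2) → c ≤ m
  pairwise-DistGe-2⇒≤ {m} n≡m+m S far = injective⇒≤ half-position-injective
    where
    position : ∀ i → ℕ
    position i = toℕ (proj₁ (cycle-position (S i)))

    half-position : ∀ i → Fin m
    half-position i = fromℕ< (⌊n/2⌋<m (position i) (subst (position i <_) n≡m+m (toℕ<n _)))

    half-position-injective : Injective _≡_ _≡_ half-position
    half-position-injective {i} {j} eq with i ≟ j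
    ... | yes i≡j = i≡j
    ... | no  i≢j = ⊥-elim (≡⊎E⇒¬DistGe-2 G
      (subst₂ (λ u v → u ≡ v ⊎ E G u v) (proj₂ (cycle-position (S i))) (proj₂ (cycle-position (S j)))
        (cycle-nearby (⌊m/2⌋≡⌊n/2⌋⇒m≡n⊎1+m≡n⊎m≡1+n _ _ (fromℕ<-injective _ _ _ _ eq))))
      (far i j i≢j))

  module Tracks {X : Subset n} (bip : IsBipartition G X) {m} (n≡m+m : n ≡ m + m) where
    open Bipartite G bip

    cycle-even-shift-DistGe-2 : ∀ {k} a → 0 < k → 2 * k < n → DistGe G (cycle a) (cycle (2 * k + a)) 2
    cycle-even-shift-DistGe-2 {k} a 0<k 2k<n = ≢∧¬E⇒DistGe-2 G
      (cycle-shift-≢ a (≤-trans 0<k (m≤m+n k _)) 2k<n)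
      (same-side⇒¬adjacent (sym (walk-side-2-periodic cycle cycle-step k a)))

    cycle-Dist-2 : ∀ a → Dist G (cycle a) (cycle (2 + a)) 2
    cycle-Dist-2 a = path⇒WalkBetween-2 G (cycle-step a) (cycle-step (suc a)) ,
                     cycle-even-shift-DistGe-2 {1} a z<s 3≤n

    track : Fin m → Fin (suc (n + n)) → Fin n
    track i t = cycle (2 * toℕ i + toℕ t)

    2*toℕ<n : ∀ (i : Fin m) → 2 * toℕ i < n
    2*toℕ<n i = subst₂ _<_ (cong (toℕ i +_) (sym (+-identityʳ (toℕ i)))) (sym n≡m+m)
                       (+-mono-< (toℕ<n i) (toℕ<n i))

    track-walk : ∀ i → IsWalk G (n + n) (track i)
    track-walk i s = subst₂ (λ a b → E G (cycle a) (cycle b))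
      (cong (2 * toℕ i +_) (sym (toℕ-inject₁ s))) (sym (+-suc (2 * toℕ i) (toℕ s)))
      (cycle-step (2 * toℕ i + toℕ s))

    -- Starting at 2i, the track is at cycle position p after p + n ∸ 2i ≤ 2n steps.
    track-surjective : ∀ i → Surjective _≡_ _≡_ (track i)
    track-surjective i v = fromℕ< t<1+2n , λ { refl → begin
        cycle (2 * toℕ i + toℕ (fromℕ< t<1+2n)) ≡⟨ cong (λ x → cycle (2 * toℕ i + x)) (toℕ-fromℕ< t<1+2n) ⟩
        cycle (2 * toℕ i + t)                     ≡⟨ cong cycle (m+[n∸m]≡n 2i≤p+n) ⟩
        cycle (toℕ p + n)                         ≡⟨ cycle-+n (toℕ p) ⟩
        cycle (toℕ p)                             ≡⟨ proj₂ (cycle-position v) ⟩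
        v                                         ∎ }
      where
      p = proj₁ (cycle-position v)
      t = toℕ p + n ∸ 2 * toℕ i
      2i≤p+n : 2 * toℕ i ≤ toℕ p + n
      2i≤p+n = ≤-trans (<⇒≤ (2*toℕ<n i)) (m≤n+m n (toℕ p))
      t<1+2n : t < suc (n + n)
      t<1+2n = s≤s (≤-trans (m∸n≤m _ (2 * toℕ i)) (+-monoˡ-≤ n (<⇒≤ (toℕ<n p))))

    ordered-tracks-DistGe-2 : ∀ {i j} → toℕ i < toℕ j → ∀ t → DistGe G (track i t) (track j t) 2
    ordered-tracks-DistGe-2 {i} {j} i<j t with m≤n⇒∃[o]m+o≡n i<j
    ... | o , 1+i+o≡j = subst (λ x → DistGe G (track i t) (cycle x) 2) shift≡
                          (cycle-even-shift-DistGe-2 _ z<s (≤-<-trans (*-monoʳ-≤ 2 1+o≤j) (2*toℕ<n j)))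
      where
      1+o≤j : suc o ≤ toℕ j
      1+o≤j = subst (suc o ≤_) 1+i+o≡j (s≤s (m≤n+m o (toℕ i)))
      regroup : ∀ a b c → 2 * suc b + (2 * a + c) ≡ 2 * (suc a + b) + c
      regroup = solve-∀
      shift≡ : 2 * suc o + (2 * toℕ i + toℕ t) ≡ 2 * toℕ j + toℕ t
      shift≡ = trans (regroup (toℕ i) o (toℕ t)) (cong (λ x → 2 * x + toℕ t) 1+i+o≡j)

    tracks-DistGe-2 : ∀ i j → i ≢ j → ∀ t → DistGe G (track i t) (track j t) 2
    tracks-DistGe-2 i j i≢j t with <-cmp (toℕ i) (toℕ j)
    ... | tri< i<j _ _ = ordered-tracks-DistGe-2 i<j t
    ... | tri≈ _ i≡j _ = contradiction (toℕ-injective i≡j) i≢j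
    ... | tri> _ _ j<i = DistGe-2-sym G (ordered-tracks-DistGe-2 j<i t)

    consecutive-tracks-Dist-2 : ∀ {i j} → toℕ j ≡ suc (toℕ i) → ∀ t → Dist G (track i t) (track j t) 2
    consecutive-tracks-Dist-2 {i} {j} j≡1+i t =
      subst (λ x → Dist G (track i t) (cycle x) 2) (sym shift≡) (cycle-Dist-2 (2 * toℕ i + toℕ t))
      where
      shift≡ : 2 * toℕ j + toℕ t ≡ 2 + (2 * toℕ i + toℕ t)
      shift≡ = cong (_+ toℕ t) (trans (cong (2 *_) j≡1+i) (*-suc 2 (toℕ i)))

    tour : 2 ≤ m → HasTour G 2 m
    tour 2≤m = n + n , track , (λ i → track-walk i , track-surjective i) , tracks-DistGe-2 ,
               i₀ , i₁ , (λ i₀≡i₁ → 1+n≢n (trans (sym i₁≡1+i₀) (cong toℕ (sym i₀≡i₁)))) ,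
               zero , consecutive-tracks-Dist-2 i₁≡1+i₀ zero
      where
      i₀ i₁ : Fin m
      i₀ = fromℕ< (≤-trans (s≤s z≤n) 2≤m)
      i₁ = fromℕ< 2≤m
      i₁≡1+i₀ : toℕ i₁ ≡ suc (toℕ i₀)
      i₁≡1+i₀ = trans (toℕ-fromℕ< 2≤m) (cong suc (sym (toℕ-fromℕ< _)))

    tour-size-≤ : ∀ {c} → HasWeakTour G 2 c → c ≤ m
    tour-size-≤ (_ , F , _ , far , _) =
      pairwise-DistGe-2⇒≤ n≡m+m (λ i → F i zero) (λ i j i≢j → far i j i≢j zero)

proposition3p12 : (n : ℕ) (G : Graph n) (X : Subset n) →
    IsBipartition G X → ∣ X ∣ ≡ ∣ ∁ X ∣ → Hamiltonian G →
    DirectCap G 2 ∣ X ∣ × StrongCap G 2 ∣ X ∣ × ∣ X ∣ ≡ n / 2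
proposition3p12 n G X bip ∣X∣≡∣∁X∣ (3≤n , h , h-walk , h-closed , h-injective) =
  (tour 2≤m , λ _ → tour-size-≤ ∘ HasTour⇒HasWeakTour G) ,
  (HasTour⇒HasWeakTour G (tour 2≤m) , λ _ → tour-size-≤) ,
  trans (sym ([m+m]/2≡m ∣ X ∣)) (cong (_/ 2) (sym n≡m+m))
  where
  n≡m+m : n ≡ ∣ X ∣ + ∣ X ∣
  n≡m+m = ∣p∣≡∣∁p∣⇒n≡∣p∣+∣p∣ X ∣X∣≡∣∁X∣
  open HamiltonianCycle G 3≤n h h-walk h-closed h-injective
  open Tracks bip {∣ X ∣} n≡m+m
  2≤m : 2 ≤ ∣ X ∣
  2≤m = 3≤m+m⇒2≤m ∣ X ∣ (subst (3 ≤_) n≡m+m 3≤n)
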